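{- Let $D,D'$ be (not necessarily distinct) $\mathbb{Z}$-clauses from which a $\mathbb{Z}$-clause $C$ is generated by one inference of the inference system $\mathcal{I}$, and let $B$ be a set of ground terms. If $D\trianglelefteq B$ and $D'\trianglelefteq B$, then $C\trianglelefteq B$.
   Context: Setting: many-sorted first-order logic with a distinguished sort $\mathbb{Z}$; the signature contains $0,-,+$ of sorts $\to\mathbb{Z}$, $\mathbb{Z}\to\mathbb{Z}$, $\mathbb{Z}\times\mathbb{Z}\to\mathbb{Z}$, and every function symbol of range $\mathbb{Z}$ has only arguments of sort $\mathbb{Z}$. Atoms are $t\le s$ ($t,s$ of sort $\mathbb{Z}$) or $t\simeq s$ ($t,s$ of the same sort); arithmetic atoms are those between terms of sort $\mathbb{Z}$. A $\mathbb{Z}$-clause is $\Lambda\|\Gamma\to\Delta$ with $\Lambda$ a finite sequence of arithmetic atoms and $\Gamma,\Delta$ finite sequences of non-arithmetic atoms in which every integer term is a variable. An abstraction atom of $C=\Lambda\|\Gamma\to\Delta$ is an atom $x\simeq t$ in $\Lambda$ with $x$ a variable; it is grounding if $t$ is ground. For a set $B$ of ground terms, $C\trianglelefteq B$ means: for every atom $x\le t$ in $\Lambda$, $\Lambda$ contains (not necessarily distinct) grounding abstraction atoms $x_1\simeq s_1,\ldots,x_n\simeq s_n$ and there are variable positions $p_1,\ldots,p_n$ of $t$ such that $x_i$ occurs at $p_i$ and $t[s_1]_{p_1}\cdots[s_n]_{p_n}\in B$. The inference system $\mathcal{I}$ (parameterized by a reduction ordering $\prec$ total on ground terms, with constants smaller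 than non-flat terms; rules modulo AC of sequences and commutativity of $\simeq$) consists of: Superposition left: from $\Lambda_1\|\Gamma_1\to\Delta_1,l\simeq r$ and $\Lambda_2\|s[l']\simeq t,\Gamma_2\to\Delta_2$ infer $(\Lambda_1,\Lambda_2\|s[r]\simeq t,\Gamma_1,\Gamma_2\to\Delta_1,\Delta_2)\sigma$ ($\sigma$ mgu of $l,l'$, $l'$ not a variable, $l\sigma\not\prec r\sigma$, $s\sigma\not\prec t\sigma$, $(l\simeq r)\sigma$ strictly maximal in its premise, $(s[l']\simeq t)\sigma$ strictly maximal in its premise); Superposition right: same with $s[l']\simeq t$ in the succedent, conclusion $(\Lambda_1,\Lambda_2\|\Gamma_1,\Gamma_2\to\Delta_1,\Delta_2,s[r]\simeq t)\sigma$; Equality factoring: from $\Lambda\|\Gamma\to\Delta,l\simeq r,l'\simeq r'$ infer $(\Lambda\|\Gamma,r\simeq r'\to\Delta,l'\simeq r')\sigma$ ($\sigma$ mgu of $l,l'$, $l\sigma\not\prec r\sigma$, $l'\sigma\not\prec r'\sigma$, $(l\simeq r)\sigma$ maximal); Ordered factoring: from $\Lambda\|\Gamma\to\Delta,E_1,E_2$ infer $(\Lambda\|\Gamma\to\Delta,E_1)\sigma$ ($\sigma$ mgu of $E_1,E_2$, $E_1\sigma$ maximal); Equality resolution: from $\Lambda\|\Gamma,s\simeq t\to\Delta$ infer $(\Lambda\|\Gamma\to\Delta)\sigma$ ($\sigma$ mgu of $s,t$, $(s\simeq t)\sigma$ maximal); Constraint refutation: from $\Lambda_1\|\to,\ldots,\Lambda_n\|\to$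 with $\mathbb{Z}$-inconsistent conjunction infer the empty clause. For unary rules, $D=D'$. -}

module Defs where

open import Data.Nat using (ℕ)
open import Data.Integer as Int using (ℤ)
open import Data.List using (List; []; _∷_; _++_; [_]; map; concat)
open import Data.List.Relation.Unary.All using (All)
open import Data.List.Relation.Unary.Any using (Any)
open import Data.List.Membership.Propositional using (_∈_)
open import Data.List.Relation.Binary.Pointwise using (Pointwise)
open import Data.List.Relation.Binary.Permutation.Homogeneous using (Permutation)
open import Data.List.Relation.Binary.Permutation.Propositional using (_↭_)
open import Data.Product using (Σ; ∃; ∃₂; _×_; _,_)
open import Data.Sum using (_⊎_)
open import Data.Empty using (⊥)
open import Data.Unit using (⊤)
open import Relation.Binary.PropositionalEquality using (_≡_; _≢_)
open import Relation.Nullary using (¬_)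
open import Induction.WellFounded using (WellFounded)

data Sort (S : Set) : Set where
  ℤₛ  : Sort S
  srt : S → Sort S

-- The symbols 0, -, + of the integer sort are
-- built into the term syntax below (constructors zeroₜ, negₜ, plusₜ);
-- Fun are the remaining function symbols.
record Signature : Set₁ where
  field
    S       : Set
    Fun     : Set
    arity   : Fun → List (Sort S)
    res     : Fun → Sort S
    intArgs : ∀ f → res f ≡ ℤₛ → All (_≡ ℤₛ) (arity f)

module Syntax (sig : Signature) where
  open Signature sig

  Srt : Set
  Srt = Sort S

  mutual
    data Term : Srt → Set where
      var   : ∀ {s} → ℕ → Term s
      zeroₜ : Term ℤₛ
      negₜ  : Term ℤₛ → Term ℤₛ
      plusₜ : Term ℤₛ → Term ℤₛ → Term ℤₛ
      app   : (f : Fun) → Args (arity f) → Term (res f)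

    data Args : List Srt → Set where
      []ₐ  : Args []
      _∷ₐ_ : ∀ {s ss} → Term s → Args ss → Args (s ∷ ss)

  ATerm : Set
  ATerm = Σ Srt Term

  Subst : Set
  Subst = ∀ {s : Srt} → ℕ → Term s

  mutual
    _⟨_⟩ : ∀ {s} → Term s → Subst → Term s
    var x     ⟨ σ ⟩ = σ x
    zeroₜ     ⟨ σ ⟩ = zeroₜ
    negₜ t    ⟨ σ ⟩ = negₜ (t ⟨ σ ⟩)
    plusₜ t u ⟨ σ ⟩ = plusₜ (t ⟨ σ ⟩) (u ⟨ σ ⟩)
    app f as  ⟨ σ ⟩ = app f (as ⟨ σ ⟩*)

    _⟨_⟩* : ∀ {ss} → Args ss → Subst → Args ss
    []ₐ       ⟨ σ ⟩* = []ₐ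
    (t ∷ₐ as) ⟨ σ ⟩* = (t ⟨ σ ⟩) ∷ₐ (as ⟨ σ ⟩*)

  substA : ATerm → Subst → ATerm
  substA (s , t) σ = s , (t ⟨ σ ⟩)

  mutual
    data Ctx (u : Srt) : Srt → Set where
      hole  : Ctx u u
      negC  : Ctx u ℤₛ → Ctx u ℤₛ
      plusL : Ctx u ℤₛ → Term ℤₛ → Ctx u ℤₛ
      plusR : Term ℤₛ → Ctx u ℤₛ → Ctx u ℤₛ
      appC  : (f : Fun) → ArgsCtx u (arity f) → Ctx u (res f)

    data ArgsCtx (u : Srt) : List Srt → Set where
      here  : ∀ {s ss} → Ctx u s → Args ss → ArgsCtx u (s ∷ ss)
      there : ∀ {s ss} → Term s → ArgsCtx u ss → ArgsCtx u (s ∷ ss)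

  mutual
    plug : ∀ {u v} → Ctx u v → Term u → Term v
    plug hole        t = t
    plug (negC C)    t = negₜ (plug C t)
    plug (plusL C a) t = plusₜ (plug C t) a
    plug (plusR a C) t = plusₜ a (plug C t)
    plug (appC f C)  t = app f (plug* C t)

    plug* : ∀ {u ss} → ArgsCtx u ss → Term u → Args ss
    plug* (here C as)  t = plug C t ∷ₐ as
    plug* (there a C) t = a ∷ₐ plug* C t

  mutual
    Ground : ∀ {s} → Term s → Set
    Ground (var _)     = ⊥
    Ground zeroₜ       = ⊤
    Ground (negₜ t)    = Ground t
    Ground (plusₜ t u) = Ground t × Ground u
    Ground (app f as)  = Grounds as

    Grounds : ∀ {ss} → Args ss → Set
    Grounds []ₐ       = ⊤
    Grounds (t ∷ₐ as) = Ground t × Grounds as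

  GroundA : ATerm → Set
  GroundA (_ , t) = Ground t

  IsVar : ∀ {s} → Term s → Set
  IsVar (var _) = ⊤
  IsVar _       = ⊥

  IsConstant : ∀ {s} → Term s → Set
  IsConstant zeroₜ      = ⊤
  IsConstant (app f _)  = arity f ≡ []
  IsConstant _          = ⊥

  VarOrConst : ∀ {s} → Term s → Set
  VarOrConst t = IsVar t ⊎ IsConstant t

  AllVarOrConst : ∀ {ss} → Args ss → Set
  AllVarOrConst []ₐ       = ⊤
  AllVarOrConst (t ∷ₐ as) = VarOrConst t × AllVarOrConst as

  Flat : ∀ {s} → Term s → Set
  Flat (var _)     = ⊤
  Flat zeroₜ       = ⊤
  Flat (negₜ t)    = VarOrConst t
  Flat (plusₜ t u) = VarOrConst t × VarOrConst u
  Flat (app f as)  = AllVarOrConst as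

  record ReductionOrdering : Set₁ where
    field
      _≺_         : ATerm → ATerm → Set
      irrefl      : ∀ {a} → ¬ (a ≺ a)
      trans       : ∀ {a b c} → a ≺ b → b ≺ c → a ≺ c
      wellFounded : WellFounded _≺_
      monotone    : ∀ {u v} (C : Ctx u v) {l r : Term u} →
                    (u , l) ≺ (u , r) → (v , plug C l) ≺ (v , plug C r)
      stable      : ∀ {a b} (σ : Subst) → a ≺ b → substA a σ ≺ substA b σ
      totalGround : ∀ {a b} → GroundA a → GroundA b → a ≺ b ⊎ a ≡ b ⊎ b ≺ a
      constMin    : ∀ {s t} {c : Term s} {d : Term t} →
                    IsConstant c → ¬ Flat d → (s , c) ≺ (t , d)

  infix 6 _≤ₐ_ _≃ₐ_
  data Atom : Set where
    _≤ₐ_ : Term ℤₛ → Term ℤₛ → Atom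
    _≃ₐ_ : ∀ {s} → Term s → Term s → Atom

  IsArith : Atom → Set
  IsArith (_ ≤ₐ _)             = ⊤
  IsArith (_≃ₐ_ {ℤₛ} _ _)     = ⊤
  IsArith (_≃ₐ_ {srt _} _ _)  = ⊥

  substAt : Subst → Atom → Atom
  substAt σ (a ≤ₐ b) = (a ⟨ σ ⟩) ≤ₐ (b ⟨ σ ⟩)
  substAt σ (a ≃ₐ b) = (a ⟨ σ ⟩) ≃ₐ (b ⟨ σ ⟩)

  atomTerms : Atom → List ATerm
  atomTerms (a ≤ₐ b)          = (ℤₛ , a) ∷ (ℤₛ , b) ∷ []
  atomTerms (_≃ₐ_ {s} a b)    = (s , a) ∷ (s , b) ∷ []

  infix 4 _‖_⇒_
  record Clause : Set where
    constructor _‖_⇒_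
    field
      Λ : List Atom
      Γ : List Atom
      Δ : List Atom
  open Clause public

  substC : Subst → Clause → Clause
  substC σ (L ‖ G ⇒ D) = map (substAt σ) L ‖ map (substAt σ) G ⇒ map (substAt σ) D

  emptyClause : Clause
  emptyClause = [] ‖ [] ⇒ []

  NotInt : Srt → Set
  NotInt ℤₛ      = ⊥
  NotInt (srt _) = ⊤

  -- every subterm of sort ℤ is a variable
  mutual
    IntVars : ∀ {s} → Term s → Set
    IntVars (var _)     = ⊤
    IntVars zeroₜ       = ⊥
    IntVars (negₜ _)    = ⊥
    IntVars (plusₜ _ _) = ⊥
    IntVars (app f as)  = NotInt (res f) × IntVars* as

    IntVars* : ∀ {ss} → Args ss → Set
    IntVars* []ₐ       = ⊤
    IntVars* (t ∷ₐ as) = IntVars t × IntVars* as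

  IntVarsAt : Atom → Set
  IntVarsAt (a ≤ₐ b) = IntVars a × IntVars b
  IntVarsAt (a ≃ₐ b) = IntVars a × IntVars b

  IsZClause : Clause → Set
  IsZClause (L ‖ G ⇒ D) =
    All IsArith L × All (λ A → ¬ IsArith A) G × All (λ A → ¬ IsArith A) D ×
    All IntVarsAt G × All IntVarsAt D

  DomOf : (S → Set) → Srt → Set
  DomOf U ℤₛ      = ℤ
  DomOf U (srt s) = U s

  DomArgs : (S → Set) → List Srt → Set
  DomArgs U []       = ⊤
  DomArgs U (s ∷ ss) = DomOf U s × DomArgs U ss

  FunInterp : (S → Set) → Set
  FunInterp U = (f : Fun) → DomArgs U (arity f) → DomOf U (res f)

  Valuation : (S → Set) → Set
  Valuation U = (s : Srt) → ℕ → DomOf U s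

  module _ (U : S → Set) (I : FunInterp U) (v : Valuation U) where
    mutual
      eval : ∀ {s} → Term s → DomOf U s
      eval {s} (var x) = v s x
      eval zeroₜ       = Int.0ℤ
      eval (negₜ t)    = Int.- eval t
      eval (plusₜ t u) = eval t Int.+ eval u
      eval (app f as)  = I f (eval* as)

      eval* : ∀ {ss} → Args ss → DomArgs U ss
      eval* []ₐ       = _
      eval* (t ∷ₐ as) = eval t , eval* as

    Sat : Atom → Set
    Sat (a ≤ₐ b) = eval a Int.≤ eval b
    Sat (a ≃ₐ b) = eval a ≡ eval b

  ZInconsistent : List Atom → Set₁
  ZInconsistent L = ∀ (U : S → Set) (I : FunInterp U) (v : Valuation U) → ¬ All (Sat U I v) L

  data Eqn : Set where
    _=?_ : ∀ {s} → Term s → Term s → Eqn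

  Unifies : Subst → Eqn → Set
  Unifies σ (a =? b) = (a ⟨ σ ⟩) ≡ (b ⟨ σ ⟩)

  IsMGU : Subst → List Eqn → Set
  IsMGU σ E = All (Unifies σ) E ×
              (∀ (θ : Subst) → All (Unifies θ) E →
                 Σ Subst λ ρ → ∀ {s : Srt} (x : ℕ) → θ {s} x ≡ ((σ {s} x) ⟨ ρ ⟩))

  data _≈ₐ_ : Atom → Atom → Set where
    ≈refl : ∀ {A} → A ≈ₐ A
    ≈swap : ∀ {s} {a b : Term s} → (a ≃ₐ b) ≈ₐ (b ≃ₐ a)

  _≈C_ : Clause → Clause → Set
  (L ‖ G ⇒ D) ≈C (L' ‖ G' ⇒ D') =
    Permutation _≈ₐ_ L L' × Permutation _≈ₐ_ G G' × Permutation _≈ₐ_ D D'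

  module Calculus (ord : ReductionOrdering) where
    open ReductionOrdering ord

    -- Huet–Oppen form of the multiset extension of ≺.
    _≺mul_ : List ATerm → List ATerm → Set
    M ≺mul N = Σ (List ATerm) λ Z → Σ (List ATerm) λ X → Σ (List ATerm) λ Y →
               (N ↭ Z ++ X) × (M ↭ Z ++ Y) × X ≢ [] × All (λ y → Any (y ≺_) X) Y

    _≺ₐ_ : Atom → Atom → Set
    A ≺ₐ B = atomTerms A ≺mul atomTerms B

    Maximal : Subst → Atom → List Atom → Set
    Maximal σ A rest = All (λ B → ¬ (substAt σ A ≺ₐ substAt σ B)) rest

    StrictlyMaximal : Subst → Atom → List Atom → Set
    StrictlyMaximal σ A rest =
      All (λ B → ¬ (substAt σ A ≺ₐ substAt σ B) ×
                 ¬ (atomTerms (substAt σ A) ↭ atomTerms (substAt σ B))) rest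

    _⊀_ : ∀ {s} → Term s → Term s → Set
    _⊀_ {s} a b = ¬ ((s , a) ≺ (s , b))

    -- The inference rules of 𝓘 (on concrete presentations of the premises).
    data RawInference : List Clause → Clause → Set₁ where
      supLeft : ∀ {u v} {Λ₁ Γ₁ Δ₁ Λ₂ Γ₂ Δ₂ : List Atom}
        (l r l' : Term u) (C : Ctx u v) (t : Term v) (σ : Subst) →
        IsMGU σ [ l =? l' ] → ¬ IsVar l' →
        (l ⟨ σ ⟩) ⊀ (r ⟨ σ ⟩) → (plug C l' ⟨ σ ⟩) ⊀ (t ⟨ σ ⟩) →
        StrictlyMaximal σ (l ≃ₐ r) (Γ₁ ++ Δ₁) →
        StrictlyMaximal σ (plug C l' ≃ₐ t) (Γ₂ ++ Δ₂) →
        RawInference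
          ((Λ₁ ‖ Γ₁ ⇒ Δ₁ ++ [ l ≃ₐ r ]) ∷ (Λ₂ ‖ (plug C l' ≃ₐ t) ∷ Γ₂ ⇒ Δ₂) ∷ [])
          (substC σ (Λ₁ ++ Λ₂ ‖ (plug C r ≃ₐ t) ∷ Γ₁ ++ Γ₂ ⇒ Δ₁ ++ Δ₂))
      supRight : ∀ {u v} {Λ₁ Γ₁ Δ₁ Λ₂ Γ₂ Δ₂ : List Atom}
        (l r l' : Term u) (C : Ctx u v) (t : Term v) (σ : Subst) →
        IsMGU σ [ l =? l' ] → ¬ IsVar l' →
        (l ⟨ σ ⟩) ⊀ (r ⟨ σ ⟩) → (plug C l' ⟨ σ ⟩) ⊀ (t ⟨ σ ⟩) →
        StrictlyMaximal σ (l ≃ₐ r) (Γ₁ ++ Δ₁) →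
        StrictlyMaximal σ (plug C l' ≃ₐ t) (Γ₂ ++ Δ₂) →
        RawInference
          ((Λ₁ ‖ Γ₁ ⇒ Δ₁ ++ [ l ≃ₐ r ]) ∷ (Λ₂ ‖ Γ₂ ⇒ Δ₂ ++ [ plug C l' ≃ₐ t ]) ∷ [])
          (substC σ (Λ₁ ++ Λ₂ ‖ Γ₁ ++ Γ₂ ⇒ Δ₁ ++ Δ₂ ++ [ plug C r ≃ₐ t ]))
      eqFactoring : ∀ {u} {L G D : List Atom} (l r l' r' : Term u) (σ : Subst) →
        IsMGU σ [ l =? l' ] →
        (l ⟨ σ ⟩) ⊀ (r ⟨ σ ⟩) → (l' ⟨ σ ⟩) ⊀ (r' ⟨ σ ⟩) →
        Maximal σ (l ≃ₐ r) (G ++ D ++ [ l' ≃ₐ r' ]) →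
        RawInference
          ((L ‖ G ⇒ D ++ (l ≃ₐ r) ∷ (l' ≃ₐ r') ∷ []) ∷ [])
          (substC σ (L ‖ (r ≃ₐ r') ∷ G ⇒ D ++ [ l' ≃ₐ r' ]))
      ordFactoring : ∀ {u} {L G D : List Atom} (a b c d : Term u) (σ : Subst) →
        IsMGU σ ((a =? c) ∷ (b =? d) ∷ []) →
        Maximal σ (a ≃ₐ b) (G ++ D ++ [ c ≃ₐ d ]) →
        RawInference
          ((L ‖ G ⇒ D ++ (a ≃ₐ b) ∷ (c ≃ₐ d) ∷ []) ∷ [])
          (substC σ (L ‖ G ⇒ D ++ [ a ≃ₐ b ]))
      eqResolution : ∀ {u} {L G D : List Atom} (s t : Term u) (σ : Subst) →
        IsMGU σ [ s =? t ] →
        Maximal σ (s ≃ₐ t) (G ++ D) →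
        RawInference
          ((L ‖ G ++ [ s ≃ₐ t ] ⇒ D) ∷ [])
          (substC σ (L ‖ G ⇒ D))
      constraintRefutation : (Ls : List (List Atom)) →
        ZInconsistent (concat Ls) →
        RawInference (map (λ L → L ‖ [] ⇒ []) Ls) emptyClause

    Inference : List Clause → Clause → Set₁
    Inference Ps C = Σ (List Clause) λ Ps' → Σ Clause λ C' →
      Pointwise _≈C_ Ps Ps' × C' ≈C C × RawInference Ps' C'

  GroundingAbs : List Atom → ℕ → Term ℤₛ → Set
  GroundingAbs L x s = Ground s × ((var x ≃ₐ s) ∈ L ⊎ (s ≃ₐ var x) ∈ L)

  mutual
    data Repl (L : List Atom) : ∀ {s} → Term s → Term s → Set where
      keepVar : ∀ {s} (x : ℕ) → Repl L (var {s} x) (var x)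
      replVar : ∀ {x : ℕ} {s : Term ℤₛ} → GroundingAbs L x s → Repl L (var x) s
      zeroR   : Repl L zeroₜ zeroₜ
      negR    : ∀ {t t'} → Repl L t t' → Repl L (negₜ t) (negₜ t')
      plusR'  : ∀ {t t' u u'} → Repl L t t' → Repl L u u' → Repl L (plusₜ t u) (plusₜ t' u')
      appR    : ∀ (f : Fun) {as bs} → Repl* L as bs → Repl L (app f as) (app f bs)

    data Repl* (L : List Atom) : ∀ {ss} → Args ss → Args ss → Set where
      []R  : Repl* L []ₐ []ₐ
      _∷R_ : ∀ {s ss} {t t' : Term s} {as bs : Args ss} →
             Repl L t t' → Repl* L as bs → Repl* L (t ∷ₐ as) (t' ∷ₐ bs)

  _⊴_ : Clause → (∀ {s} → Term s → Set) → Set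
  C ⊴ B = ∀ {x : ℕ} {t : Term ℤₛ} → (var x ≤ₐ t) ∈ Λ C →
          Σ (Term ℤₛ) λ u → Repl (Λ C) t u × B u

-- The mgu σ of an inference unifies terms whose integer subterms are all
-- variables, so it maps integer variables to integer variables.  Hence the
-- constraint part of the conclusion is a variable renaming of (the
-- concatenation of) the constraint parts of the premises, and C ⊴ B is
-- stable under concatenation, renaming and reordering of constraints.
module Submission where

open import Defs
open import Data.List using (List; []; _∷_; _++_; map)
open import Data.List.Relation.Unary.All as All using (All; []; _∷_)
open import Data.List.Relation.Unary.All.Properties using (++⁻ʳ)
open import Data.List.Membership.Propositional using (_∈_; find; lose)
open import Data.List.Membership.Propositional.Properties using (∈-++⁻; ∈-map⁺; ∈-map⁻)
open import Data.List.Relation.Binary.Subset.Propositional using (_⊆_)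
open import Data.List.Relation.Binary.Subset.Propositional.Properties using (xs⊆xs++ys; xs⊆ys++xs)
open import Data.List.Relation.Binary.Pointwise using (All-resp-Pointwise)
open import Data.List.Relation.Binary.Permutation.Homogeneous using (Permutation)
import Data.List.Relation.Binary.Permutation.Setoid as PermutationSetoid
import Data.List.Relation.Binary.Permutation.Setoid.Properties as PermutationProperties
open import Data.Product using (∃-syntax; _×_; _,_)
open import Data.Sum using (inj₁; inj₂)
open import Data.Nat using (ℕ)
open import Relation.Binary.Bundles using (Setoid)
open import Relation.Binary.PropositionalEquality

module _ (sig : Signature) where
  open Syntax sig

  ≈ₐ-sym : ∀ {A A'} → A ≈ₐ A' → A' ≈ₐ A
  ≈ₐ-sym ≈refl = ≈refl
  ≈ₐ-sym ≈swap = ≈swap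

  ≈ₐ-trans : ∀ {A A' A''} → A ≈ₐ A' → A' ≈ₐ A'' → A ≈ₐ A''
  ≈ₐ-trans ≈refl q     = q
  ≈ₐ-trans ≈swap ≈refl = ≈swap
  ≈ₐ-trans ≈swap ≈swap = ≈refl

  ≈ₐ-setoid : Setoid _ _
  ≈ₐ-setoid = record
    { Carrier       = Atom
    ; _≈_           = _≈ₐ_
    ; isEquivalence = record { refl = ≈refl ; sym = ≈ₐ-sym ; trans = ≈ₐ-trans }
    }

  open PermutationSetoid ≈ₐ-setoid using (↭-sym)
  open PermutationProperties ≈ₐ-setoid using (Any-resp-↭; All-resp-↭)

  infix 4 _⊆≈_
  _⊆≈_ : List Atom → List Atom → Set
  L ⊆≈ M = ∀ {A} → A ∈ L → ∃[ A' ] A' ∈ M × A ≈ₐ A'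

  ⊆⇒⊆≈ : ∀ {L M} → L ⊆ M → L ⊆≈ M
  ⊆⇒⊆≈ L⊆M A∈L = _ , L⊆M A∈L , ≈refl

  ↭⇒⊆≈ : ∀ {L M} → Permutation _≈ₐ_ L M → L ⊆≈ M
  ↭⇒⊆≈ L↭M A∈L = find (Any-resp-↭ (λ A≈B B≈C → ≈ₐ-trans B≈C A≈B) L↭M (lose A∈L ≈refl))

  GroundingAbs-mono : ∀ {L M x s} → L ⊆≈ M → GroundingAbs L x s → GroundingAbs M x s
  GroundingAbs-mono L⊆≈M (g , inj₁ A∈L) with L⊆≈M A∈L
  ... | _ , A∈M , ≈refl = g , inj₁ A∈M
  ... | _ , A∈M , ≈swap = g , inj₂ A∈M
  GroundingAbs-mono L⊆≈M (g , inj₂ A∈L) with L⊆≈M A∈L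
  ... | _ , A∈M , ≈refl = g , inj₂ A∈M
  ... | _ , A∈M , ≈swap = g , inj₁ A∈M

  mutual
    Repl-mono : ∀ {L M s} {t u : Term s} → L ⊆≈ M → Repl L t u → Repl M t u
    Repl-mono L⊆≈M (keepVar x)   = keepVar x
    Repl-mono L⊆≈M (replVar ga)  = replVar (GroundingAbs-mono L⊆≈M ga)
    Repl-mono L⊆≈M zeroR         = zeroR
    Repl-mono L⊆≈M (negR r)      = negR (Repl-mono L⊆≈M r)
    Repl-mono L⊆≈M (plusR' r r') = plusR' (Repl-mono L⊆≈M r) (Repl-mono L⊆≈M r')
    Repl-mono L⊆≈M (appR f rs)   = appR f (Repl*-mono L⊆≈M rs)

    Repl*-mono : ∀ {L M ss} {as bs : Args ss} → L ⊆≈ M → Repl* L as bs → Repl* M as bs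
    Repl*-mono L⊆≈M []R       = []R
    Repl*-mono L⊆≈M (r ∷R rs) = Repl-mono L⊆≈M r ∷R Repl*-mono L⊆≈M rs

  infix 4 _⊴Λ_
  _⊴Λ_ : List Atom → (∀ {s} → Term s → Set) → Set
  L ⊴Λ B = ∀ {x : ℕ} {t : Term ℤₛ} → (var x ≤ₐ t) ∈ L → ∃[ u ] Repl L t u × B u

  module _ {B : ∀ {s} → Term s → Set} where

    ⊴Λ-resp-↭ : ∀ {L M} → Permutation _≈ₐ_ L M → L ⊴Λ B → M ⊴Λ B
    ⊴Λ-resp-↭ L↭M L⊴B A∈M with ↭⇒⊆≈ (↭-sym L↭M) A∈M
    ... | _ , A∈L , ≈refl = let u , r , Bu = L⊴B A∈L in u , Repl-mono (↭⇒⊆≈ L↭M) r , Bu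

    ⊴-resp-≈C : ∀ {C C'} → C ≈C C' → C ⊴ B → C' ⊴ B
    ⊴-resp-≈C (Λ↭ , _) = ⊴Λ-resp-↭ Λ↭

    ⊴Λ-++ : ∀ {L₁ L₂} → L₁ ⊴Λ B → L₂ ⊴Λ B → L₁ ++ L₂ ⊴Λ B
    ⊴Λ-++ {L₁} {L₂} L₁⊴B L₂⊴B A∈L with ∈-++⁻ L₁ A∈L
    ... | inj₁ A∈L₁ = let u , r , Bu = L₁⊴B A∈L₁ in u , Repl-mono (⊆⇒⊆≈ (xs⊆xs++ys L₁ L₂)) r , Bu
    ... | inj₂ A∈L₂ = let u , r , Bu = L₂⊴B A∈L₂ in u , Repl-mono (⊆⇒⊆≈ (xs⊆ys++xs L₂ L₁)) r , Bu

  mutual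
    ⟨⟩-ground : ∀ {s} (σ : Subst) {t : Term s} → Ground t → t ⟨ σ ⟩ ≡ t
    ⟨⟩-ground σ {zeroₜ}     _       = refl
    ⟨⟩-ground σ {negₜ t}    g       = cong negₜ (⟨⟩-ground σ g)
    ⟨⟩-ground σ {plusₜ t u} (g , h) = cong₂ plusₜ (⟨⟩-ground σ g) (⟨⟩-ground σ h)
    ⟨⟩-ground σ {app f as}  g       = cong (app f) (⟨⟩*-ground σ g)

    ⟨⟩*-ground : ∀ {ss} (σ : Subst) {as : Args ss} → Grounds as → as ⟨ σ ⟩* ≡ as
    ⟨⟩*-ground σ {[]ₐ}     _       = refl
    ⟨⟩*-ground σ {t ∷ₐ as} (g , h) = cong₂ _∷ₐ_ (⟨⟩-ground σ g) (⟨⟩*-ground σ h)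

  ⟨⟩≡var⇒var : ∀ {s} (t : Term s) (ρ : Subst) {x : ℕ} → t ⟨ ρ ⟩ ≡ var x → ∃[ y ] t ≡ var y
  ⟨⟩≡var⇒var (var y) ρ _ = y , refl

  ≤ₐ-injective : ∀ {a b c d : Term ℤₛ} → (a ≤ₐ b) ≡ (c ≤ₐ d) → a ≡ c × b ≡ d
  ≤ₐ-injective refl = refl , refl

  GroundingAbs-rename : ∀ {σ : Subst} {L x y s} → σ x ≡ var y →
                        GroundingAbs L x s → GroundingAbs (map (substAt σ) L) y s
  GroundingAbs-rename {σ} {L} σx≡y (g , inj₁ A∈L) =
    g , inj₁ (subst₂ (λ a b → (a ≃ₐ b) ∈ map (substAt σ) L)
                     σx≡y (⟨⟩-ground σ g) (∈-map⁺ (substAt σ) A∈L))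
  GroundingAbs-rename {σ} {L} σx≡y (g , inj₂ A∈L) =
    g , inj₂ (subst₂ (λ a b → (b ≃ₐ a) ∈ map (substAt σ) L)
                     σx≡y (⟨⟩-ground σ g) (∈-map⁺ (substAt σ) A∈L))

  IntRenaming : Subst → Set
  IntRenaming σ = ∀ x → ∃[ y ] σ {ℤₛ} x ≡ var y

  module _ {σ : Subst} (ren : IntRenaming σ) where

    -- Since u is ground, every variable of t has been replaced (no keepVar).
    mutual
      Repl-rename : ∀ {L s} {t u : Term s} → Repl L t u → Ground u →
                    Repl (map (substAt σ) L) (t ⟨ σ ⟩) u
      Repl-rename {L} (replVar {x} {s} ga) _ with ren x
      ... | y , σx≡y = subst (λ v → Repl (map (substAt σ) L) v s) (sym σx≡y)
                             (replVar (GroundingAbs-rename σx≡y ga))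
      Repl-rename zeroR         _       = zeroR
      Repl-rename (negR r)      g       = negR (Repl-rename r g)
      Repl-rename (plusR' r r') (g , h) = plusR' (Repl-rename r g) (Repl-rename r' h)
      Repl-rename (appR f rs)   g       = appR f (Repl*-rename rs g)

      Repl*-rename : ∀ {L ss} {as bs : Args ss} → Repl* L as bs → Grounds bs →
                     Repl* (map (substAt σ) L) (as ⟨ σ ⟩*) bs
      Repl*-rename []R       _       = []R
      Repl*-rename (r ∷R rs) (g , h) = Repl-rename r g ∷R Repl*-rename rs h

    ⊴Λ-rename : ∀ {B : ∀ {s} → Term s → Set} {L} → (∀ {s} {t : Term s} → B t → Ground t) →
                L ⊴Λ B → map (substAt σ) L ⊴Λ B
    ⊴Λ-rename B⊆Ground L⊴B A∈Lσ with ∈-map⁻ (substAt σ) A∈Lσ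
    ... | (a ≤ₐ b) , A∈L , A≡ with ≤ₐ-injective A≡
    ...   | x≡aσ , refl with ⟨⟩≡var⇒var a σ (sym x≡aσ)
    ...     | _ , refl = let u , r , Bu = L⊴B A∈L in u , Repl-rename r (B⊆Ground Bu) , Bu

  mutual
    collapseNonInt : ∀ {s} → Term s → Term s
    collapseNonInt (app f as) = app f (collapse* as)
    collapseNonInt t          = t

    collapse : ∀ {s} → Term s → Term s
    collapse {ℤₛ}    _ = var 0
    collapse {srt _} t = collapseNonInt t

    collapse* : ∀ {ss} → Args ss → Args ss
    collapse* []ₐ       = []ₐ
    collapse* (t ∷ₐ as) = collapse t ∷ₐ collapse* as

  collapse-NotInt : ∀ {s} (t : Term s) → NotInt s → collapse t ≡ collapseNonInt t
  collapse-NotInt {srt _} t _ = refl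

  collapseAfter : Subst → Subst
  collapseAfter σ {s} x = collapse (σ {s} x)

  mutual
    ⟨⟩-collapse : ∀ {s} (σ : Subst) (t : Term s) → IntVars t →
                  t ⟨ collapseAfter σ ⟩ ≡ collapse (t ⟨ σ ⟩)
    ⟨⟩-collapse σ (var x)    _          = refl
    ⟨⟩-collapse σ (app f as) (ni , ivs) =
      trans (cong (app f) (⟨⟩*-collapse σ as ivs)) (sym (collapse-NotInt (app f (as ⟨ σ ⟩*)) ni))

    ⟨⟩*-collapse : ∀ {ss} (σ : Subst) (as : Args ss) → IntVars* as →
                   as ⟨ collapseAfter σ ⟩* ≡ collapse* (as ⟨ σ ⟩*)
    ⟨⟩*-collapse σ []ₐ       _         = refl
    ⟨⟩*-collapse σ (t ∷ₐ as) (iv , ivs) = cong₂ _∷ₐ_ (⟨⟩-collapse σ t iv) (⟨⟩*-collapse σ as ivs)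

  IntVarsEqn : Eqn → Set
  IntVarsEqn (a =? b) = IntVars a × IntVars b

  Unifies-collapse : ∀ {σ : Subst} {e} → IntVarsEqn e × Unifies σ e → Unifies (collapseAfter σ) e
  Unifies-collapse {σ} {a =? b} ((iva , ivb) , aσ≡bσ) =
    trans (⟨⟩-collapse σ a iva) (trans (cong collapse aσ≡bσ) (sym (⟨⟩-collapse σ b ivb)))

  -- σ followed by the collapse is again a unifier, hence an instance of σ;
  -- as it sends integer variables to var 0, σ must send them to variables.
  mgu⇒IntRenaming : ∀ {σ : Subst} {E} → All IntVarsEqn E → IsMGU σ E → IntRenaming σ
  mgu⇒IntRenaming {σ} ivs (unifies , mostGeneral) x =
    let ρ , collapseσ≡σρ = mostGeneral (collapseAfter σ)
                                       (All.zipWith Unifies-collapse (ivs , unifies))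
    in ⟨⟩≡var⇒var (σ x) ρ (sym (collapseσ≡σρ x))

  mutual
    IntVars-plug : ∀ {u v} (C : Ctx u v) (t : Term u) → IntVars (plug C t) → IntVars t
    IntVars-plug hole       t iv       = iv
    IntVars-plug (appC f C) t (_ , iv) = IntVars*-plug C t iv

    IntVars*-plug : ∀ {u ss} (C : ArgsCtx u ss) (t : Term u) → IntVars* (plug* C t) → IntVars t
    IntVars*-plug (here C _)  t (iv , _) = IntVars-plug C t iv
    IntVars*-plug (there _ C) t (_ , iv) = IntVars*-plug C t iv

  IntVarsClause : Clause → Set
  IntVarsClause C = All IntVarsAt (Γ C) × All IntVarsAt (Δ C)

  IntVarsAt-resp-≈ₐ : ∀ {A A'} → A ≈ₐ A' → IntVarsAt A → IntVarsAt A'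
  IntVarsAt-resp-≈ₐ ≈refl iv       = iv
  IntVarsAt-resp-≈ₐ ≈swap (iv , jv) = jv , iv

  IntVarsClause-resp-≈C : ∀ {C C'} → C ≈C C' → IntVarsClause C → IntVarsClause C'
  IntVarsClause-resp-≈C (_ , Γ↭ , Δ↭) (ivΓ , ivΔ) =
    All-resp-↭ IntVarsAt-resp-≈ₐ Γ↭ ivΓ , All-resp-↭ IntVarsAt-resp-≈ₐ Δ↭ ivΔ

  IsZClause⇒IntVarsClause : ∀ {C} → IsZClause C → IntVarsClause C
  IsZClause⇒IntVarsClause (_ , _ , _ , ivΓ , ivΔ) = ivΓ , ivΔ

  module _ (ord : ReductionOrdering) (B : ∀ {s} → Term s → Set)
           (B⊆Ground : ∀ {s} {t : Term s} → B t → Ground t) where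
    open Calculus ord

    private
      ⊴-instance : ∀ {σ : Subst} {E L} → All IntVarsEqn E → IsMGU σ E →
                   L ⊴Λ B → map (substAt σ) L ⊴Λ B
      ⊴-instance ivs mgu = ⊴Λ-rename (mgu⇒IntRenaming ivs mgu) {B = B} B⊆Ground

    RawInference-⊴ : ∀ {Ps C} → RawInference Ps C → All IntVarsClause Ps →
                     All (_⊴ B) Ps → C ⊴ B
    RawInference-⊴ (supLeft {Δ₁ = Δ₁} l r l' C t σ mgu _ _ _ _ _)
                   ((_ , ivΔ₁) ∷ (ivC ∷ _ , _) ∷ []) (D₁⊴B ∷ D₂⊴B ∷ [])
      with ++⁻ʳ Δ₁ ivΔ₁ | ivC
    ... | (ivl , _) ∷ [] | (ivCl' , _) =
      ⊴-instance ((ivl , IntVars-plug C l' ivCl') ∷ []) mgu (⊴Λ-++ {B = B} D₁⊴B D₂⊴B)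
    RawInference-⊴ (supRight {Δ₁ = Δ₁} {Δ₂ = Δ₂} l r l' C t σ mgu _ _ _ _ _)
                   ((_ , ivΔ₁) ∷ (_ , ivΔ₂) ∷ []) (D₁⊴B ∷ D₂⊴B ∷ [])
      with ++⁻ʳ Δ₁ ivΔ₁ | ++⁻ʳ Δ₂ ivΔ₂
    ... | (ivl , _) ∷ [] | (ivCl' , _) ∷ [] =
      ⊴-instance ((ivl , IntVars-plug C l' ivCl') ∷ []) mgu (⊴Λ-++ {B = B} D₁⊴B D₂⊴B)
    RawInference-⊴ (eqFactoring {D = D} l r l' r' σ mgu _ _ _) ((_ , ivΔ) ∷ []) (D⊴B ∷ [])
      with ++⁻ʳ D ivΔ
    ... | (ivl , _) ∷ (ivl' , _) ∷ [] = ⊴-instance ((ivl , ivl') ∷ []) mgu D⊴B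
    RawInference-⊴ (ordFactoring {D = D} a b c d σ mgu _) ((_ , ivΔ) ∷ []) (D⊴B ∷ [])
      with ++⁻ʳ D ivΔ
    ... | (iva , ivb) ∷ (ivc , ivd) ∷ [] = ⊴-instance ((iva , ivc) ∷ (ivb , ivd) ∷ []) mgu D⊴B
    RawInference-⊴ (eqResolution {G = G} s t σ mgu _) ((ivΓ , _) ∷ []) (D⊴B ∷ [])
      with ++⁻ʳ G ivΓ
    ... | ivst ∷ [] = ⊴-instance (ivst ∷ []) mgu D⊴B
    RawInference-⊴ (constraintRefutation _ _) _ _ ()

lemma1 : (sig : Signature) → let open Syntax sig in
    (ord : ReductionOrdering) → let open Calculus ord in
    (B : ∀ {s} → Term s → Set) → (∀ {s} {t : Term s} → B t → Ground t) →
    (Ps : List Clause) (C : Clause) →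
    All IsZClause Ps → IsZClause C → Inference Ps C →
    All (λ D → D ⊴ B) Ps → C ⊴ B
lemma1 sig ord B B⊆Ground Ps C zPs _ (Ps' , C' , Ps≈Ps' , C'≈C , raw) Ps⊴B =
  ⊴-resp-≈C sig {B = B} C'≈C
    (RawInference-⊴ sig ord B B⊆Ground raw
      (All-resp-Pointwise (IntVarsClause-resp-≈C sig) Ps≈Ps'
        (All.map (IsZClause⇒IntVarsClause sig) zPs))
      (All-resp-Pointwise (⊴-resp-≈C sig {B = B}) Ps≈Ps' Ps⊴B))
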